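{- Every induced subgraph of a sesquicograph is a sesquicograph.
   Context: All graphs are finite and simple. For vertex-disjoint graphs $G$ and $H$: the $0$-sum is their disjoint union; a $1$-sum is obtained from the disjoint union by identifying one vertex of $G$ with one vertex of $H$; the join is obtained from the disjoint union by adding all edges between $V(G)$ and $V(H)$. A sesquicograph is a graph that can be generated from the one-vertex graph $K_1$ using joins, $0$-sums and $1$-sums. -}

module Defs where

open import Data.Nat using (ℕ; zero; suc; _+_)
open import Data.Bool using (Bool; true; false; if_then_else_)
open import Data.Fin using (Fin; splitAt; _≟_; punchIn)
open import Data.Sum using (_⊎_; inj₁; inj₂)
open import Relation.Nullary using (does)
open import Relation.Binary.PropositionalEquality using (_≡_; refl)
open import Function.Definitions using (Injective)
open import Function.Bundles using (_↔_; Inverse)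

record Graph : Set where
  field
    n      : ℕ
    adj    : Fin n → Fin n → Bool
    sym    : ∀ i j → adj i j ≡ adj j i
    irrefl : ∀ i → adj i i ≡ false
open Graph public

K1 : Graph
K1 = record { n = 1 ; adj = λ _ _ → false ; sym = λ _ _ → refl ; irrefl = λ _ → refl }

private
  onSum : (a b : ℕ) (r : Fin a ⊎ Fin b → Fin a ⊎ Fin b → Bool) →
          (∀ x y → r x y ≡ r y x) → (∀ x → r x x ≡ false) → Graph
  onSum a b r s ir = record
    { n = a + b
    ; adj = λ i j → r (splitAt a i) (splitAt a j)
    ; sym = λ i j → s (splitAt a i) (splitAt a j)
    ; irrefl = λ i → ir (splitAt a i) }

-- disjoint union (0-sum) and join: vertices of G come first, then those of H
module _ (G H : Graph) where
  private
    r : Bool → Fin (n G) ⊎ Fin (n H) → Fin (n G) ⊎ Fin (n H) → Bool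
    r c (inj₁ x) (inj₁ y) = adj G x y
    r c (inj₂ x) (inj₂ y) = adj H x y
    r c (inj₁ x) (inj₂ y) = c
    r c (inj₂ x) (inj₁ y) = c
    rs : ∀ c x y → r c x y ≡ r c y x
    rs c (inj₁ x) (inj₁ y) = sym G x y
    rs c (inj₂ x) (inj₂ y) = sym H x y
    rs c (inj₁ x) (inj₂ y) = refl
    rs c (inj₂ x) (inj₁ y) = refl
    ri : ∀ c x → r c x x ≡ false
    ri c (inj₁ x) = irrefl G x
    ri c (inj₂ x) = irrefl H x

  zeroSum : Graph
  zeroSum = onSum (n G) (n H) (r false) (rs false) (ri false)

  join : Graph
  join = onSum (n G) (n H) (r true) (rs true) (ri true)

-- 1-sum: identify vertex u of G with vertex v of H (H has suc m vertices).
-- Vertices: those of G (u playing the role of the identified vertex),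
-- followed by the vertices of H other than v (vertex k of the second block
-- is  punchIn v k  in H).
module _ (G : Graph) (m : ℕ) (a : Fin (suc m) → Fin (suc m) → Bool)
         (as : ∀ i j → a i j ≡ a j i) (ai : ∀ i → a i i ≡ false)
         (u : Fin (n G)) (v : Fin (suc m)) where
  private
    r : Fin (n G) ⊎ Fin m → Fin (n G) ⊎ Fin m → Bool
    r (inj₁ x) (inj₁ y) = adj G x y
    r (inj₂ x) (inj₂ y) = a (punchIn v x) (punchIn v y)
    r (inj₁ x) (inj₂ y) = if does (x ≟ u) then a v (punchIn v y) else false
    r (inj₂ x) (inj₁ y) = if does (y ≟ u) then a v (punchIn v x) else false
    rs : ∀ x y → r x y ≡ r y x
    rs (inj₁ x) (inj₁ y) = sym G x y
    rs (inj₂ x) (inj₂ y) = as (punchIn v x) (punchIn v y)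
    rs (inj₁ x) (inj₂ y) = refl
    rs (inj₂ x) (inj₁ y) = refl
    ri : ∀ x → r x x ≡ false
    ri (inj₁ x) = irrefl G x
    ri (inj₂ x) = ai (punchIn v x)

  oneSumAux : Graph
  oneSumAux = onSum (n G) m r rs ri

oneSum : (G H : Graph) → Fin (n G) → Fin (n H) → Graph
oneSum G H u v = go (n H) (adj H) (sym H) (irrefl H) v
  where
    go : (k : ℕ) (a : Fin k → Fin k → Bool) → (∀ i j → a i j ≡ a j i) →
         (∀ i → a i i ≡ false) → Fin k → Graph
    go (suc m) a as ai w = oneSumAux G m a as ai u w

record _≅_ (G H : Graph) : Set where
  field
    bij   : Fin (n G) ↔ Fin (n H)
    preserves : ∀ i j → adj H (Inverse.to bij i) (Inverse.to bij j) ≡ adj G i j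

-- sesquicographs: generated from K₁ by joins, 0-sums and 1-sums
-- (closed under isomorphism, as graphs are considered up to isomorphism)
data Sesquicograph : Graph → Set where
  k1      : Sesquicograph K1
  zero-sum : ∀ {G H} → Sesquicograph G → Sesquicograph H → Sesquicograph (zeroSum G H)
  one-sum  : ∀ {G H} → Sesquicograph G → Sesquicograph H →
             (u : Fin (n G)) (v : Fin (n H)) → Sesquicograph (oneSum G H u v)
  joined   : ∀ {G H} → Sesquicograph G → Sesquicograph H → Sesquicograph (join G H)
  iso      : ∀ {G H} → Sesquicograph G → G ≅ H → Sesquicograph H

-- the induced subgraph of G on a nonempty vertex subset, given as the image
-- of an injective map f : Fin (suc k) → V(G)
induced : (G : Graph) (k : ℕ) (f : Fin (suc k) → Fin (n G)) → Injective _≡_ _≡_ f → Graph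
induced G k f _ = record
  { n = suc k
  ; adj = λ i j → adj G (f i) (f j)
  ; sym = λ i j → sym G (f i) (f j)
  ; irrefl = λ i → irrefl G (f i) }

-- The vertices of an induced subgraph X of a 0-sum or a
-- join of G and H split into those of G and those of H; X is then the corresponding sum of
-- the two induced parts, or lies inside G or H.  For a 1-sum identifying u ∈ G with v ∈ H,
-- X is the 1-sum of its G-part and its H-part completed by v when X contains u, and the
-- 0-sum of the two parts otherwise.  Isomorphisms carry induced subgraphs along.

module Submission where

open import Defs
open import Data.Bool using (Bool; true; false; if_then_else_)
open import Data.Empty using (⊥-elim)
open import Data.Fin using (Fin; zero; suc; splitAt; punchIn; _≟_)
open import Data.Fin.Properties using (+↔⊎; punchIn-injective; punchInᵢ≢i; any?; <⇒notInjective)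
open import Data.Nat using (ℕ; zero; suc; s<s; z<s)
open import Data.Product using (_,_)
open import Data.Sum using (_⊎_; inj₁; inj₂; [_,_]; swap; map; map₁)
open import Data.Sum.Properties using (inj₁-injective; inj₂-injective; swap-involutive; swap-↔)
open import Data.Vec.Functional using (_∷_)
open import Function using (_∘_)
open import Function.Bundles using (_↔_; Inverse; Injection; mk↔ₛ′; mk⇔)
open import Function.Definitions using (Injective)
open import Function.Properties.Inverse using (↔-refl; ↔-sym; ↔-trans; ↔⇒↣)
open import Relation.Nullary using (does; yes; no)
open import Relation.Nullary.Decidable using (dec-false; does-⇔)
open import Relation.Binary.PropositionalEquality
  using (_≡_; _≢_; _≗_; refl; trans; cong; cong₂) renaming (sym to ≡-sym)

private
  variable
    A B : Set
    N : ℕ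

↔-injective : (φ : A ↔ B) → Injective _≡_ _≡_ (Inverse.to φ)
↔-injective = Injection.injective ∘ ↔⇒↣

↔⊎0 : Fin N ↔ (Fin N ⊎ Fin 0)
↔⊎0 = mk↔ₛ′ inj₁ [ (λ i → i) , (λ ()) ] [ (λ _ → refl) , (λ ()) ] (λ _ → refl)

↔0⊎ : Fin N ↔ (Fin 0 ⊎ Fin N)
↔0⊎ = mk↔ₛ′ inj₂ [ (λ ()) , (λ i → i) ] [ (λ ()) , (λ _ → refl) ] (λ _ → refl)

record Partition (h : Fin N → A ⊎ B) : Set where
  field
    p q    : ℕ
    blocks : Fin N ↔ (Fin p ⊎ Fin q)
    left   : Fin p → A
    right  : Fin q → B
    h-from : ∀ s → h (Inverse.from blocks s) ≡ map left right s

  open Inverse blocks public using (to; from)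

  module _ (h-injective : Injective _≡_ _≡_ h) where
    map-injective : Injective _≡_ _≡_ (map left right)
    map-injective {s} {t} e = ↔-injective (↔-sym blocks)
      (h-injective (trans (h-from s) (trans e (≡-sym (h-from t)))))

    left-injective : Injective _≡_ _≡_ left
    left-injective = inj₁-injective ∘ map-injective ∘ cong inj₁

    right-injective : Injective _≡_ _≡_ right
    right-injective = inj₂-injective ∘ map-injective ∘ cong inj₂

open Partition using (p; q; blocks; left; right; h-from; left-injective; right-injective)

Partition-cong : ∀ {h h′ : Fin N → A ⊎ B} → h ≗ h′ → Partition h → Partition h′
Partition-cong h≗h′ P = record
  { Partition P; h-from = λ s → trans (≡-sym (h≗h′ (Partition.from P s))) (h-from P s) }

swapped : ∀ {h : Fin N → A ⊎ B} → Partition h → Partition (swap ∘ h)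
swapped {h = h} P = record
  { p = q P; q = p P; blocks = ↔-trans (blocks P) swap-↔
  ; left = right P; right = left P; h-from = h-from′ }
  where
    h-from′ : ∀ s → swap (h (Partition.from P (swap s))) ≡ map (right P) (left P) s
    h-from′ (inj₁ x) = cong swap (h-from P (inj₂ x))
    h-from′ (inj₂ y) = cong swap (h-from P (inj₁ y))

extendˡ : ∀ {h : Fin (suc N) → A ⊎ B} (a : A) → h zero ≡ inj₁ a → Partition (h ∘ suc) → Partition h
extendˡ {h = h} a h0≡a P = record
  { p = suc (p P); q = q P; blocks = mk↔ₛ′ to′ from′ to∘from′ from∘to′
  ; left = a ∷ left P ; right = right P; h-from = h-from′ }
  where
    to′ : Fin (suc _) → Fin (suc (p P)) ⊎ Fin (q P)
    to′ zero    = inj₁ zero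
    to′ (suc i) = map₁ suc (Partition.to P i)
    from′ : Fin (suc (p P)) ⊎ Fin (q P) → Fin (suc _)
    from′ (inj₁ zero)    = zero
    from′ (inj₁ (suc x)) = suc (Partition.from P (inj₁ x))
    from′ (inj₂ y)       = suc (Partition.from P (inj₂ y))
    from′-suc : ∀ s → from′ (map₁ suc s) ≡ suc (Partition.from P s)
    from′-suc (inj₁ x) = refl
    from′-suc (inj₂ y) = refl
    to∘from′ : ∀ s → to′ (from′ s) ≡ s
    to∘from′ (inj₁ zero)    = refl
    to∘from′ (inj₁ (suc x)) = cong (map₁ suc) (Inverse.strictlyInverseˡ (blocks P) (inj₁ x))
    to∘from′ (inj₂ y)       = cong (map₁ suc) (Inverse.strictlyInverseˡ (blocks P) (inj₂ y))
    from∘to′ : ∀ i → from′ (to′ i) ≡ i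
    from∘to′ zero    = refl
    from∘to′ (suc i) =
      trans (from′-suc (Partition.to P i)) (cong suc (Inverse.strictlyInverseʳ (blocks P) i))
    h-from′ : ∀ s → h (from′ s) ≡ map (a ∷ left P) (right P) s
    h-from′ (inj₁ zero)    = h0≡a
    h-from′ (inj₁ (suc x)) = h-from P (inj₁ x)
    h-from′ (inj₂ y)       = h-from P (inj₂ y)

extendʳ : ∀ {h : Fin (suc N) → A ⊎ B} (b : B) → h zero ≡ inj₂ b → Partition (h ∘ suc) → Partition h
extendʳ b h0≡b P =
  Partition-cong (swap-involutive ∘ _) (swapped (extendˡ b (cong swap h0≡b) (swapped P)))

partition : (h : Fin N → A ⊎ B) → Partition h
partition {N = zero} h = record
  { p = 0; q = 0; blocks = mk↔ₛ′ (λ ()) [ (λ ()) , (λ ()) ] [ (λ ()) , (λ ()) ] (λ ())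
  ; left = λ (); right = λ (); h-from = [ (λ ()) , (λ ()) ] }
partition {N = suc N} h with h zero in h0
... | inj₁ a = extendˡ a h0 (partition (h ∘ suc))
... | inj₂ b = extendʳ b h0 (partition (h ∘ suc))

Hereditary : Graph → Set
Hereditary G = ∀ k (f : Fin (suc k) → Fin (n G)) (inj : Injective _≡_ _≡_ f) →
  Sesquicograph (induced G k f inj)

≅-sym : ∀ {G H} → G ≅ H → H ≅ G
≅-sym {G} {H} φ = record
  { bij = ↔-sym bij
  ; preserves = λ i j → trans (≡-sym (preserves (from i) (from j)))
                               (cong₂ (adj H) (strictlyInverseˡ i) (strictlyInverseˡ j)) }
  where open _≅_ φ; open Inverse bij

hereditary-≅ : ∀ {G H} → G ≅ H → Hereditary G → Hereditary H
hereditary-≅ φ ihG k f inj =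
  iso (ihG k (to ∘ f) (inj ∘ ↔-injective bij))
      (record { bij = ↔-refl ; preserves = λ i j → ≡-sym (preserves (f i) (f j)) })
  where open _≅_ (≅-sym φ); open Inverse bij

hereditary-K1 : Hereditary K1
hereditary-K1 zero    f inj = k1
hereditary-K1 (suc k) f inj = ⊥-elim (<⇒notInjective (s<s z<s) inj)

module Blocks {S : Graph} (σ : Fin (n S) ↔ (A ⊎ B)) (R : A ⊎ B → A ⊎ B → Bool)
  (adj-S : ∀ i j → adj S i j ≡ R (Inverse.to σ i) (Inverse.to σ j))
  {k : ℕ} {f : Fin (suc k) → Fin (n S)} (inj : Injective _≡_ _≡_ f) where

  blocks-injective : Injective _≡_ _≡_ (Inverse.to σ ∘ f)
  blocks-injective = inj ∘ ↔-injective σ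

  ≅-induced : (P : Partition (Inverse.to σ ∘ f)) (Y : Graph) (τ : Fin (n Y) ↔ (Fin (p P) ⊎ Fin (q P))) →
    (∀ i j → adj Y i j ≡ R (map (left P) (right P) (Inverse.to τ i))
                           (map (left P) (right P) (Inverse.to τ j))) →
    Y ≅ induced S k f inj
  ≅-induced P Y τ adj-Y = record
    { bij = ↔-trans τ (↔-sym (blocks P))
    ; preserves = λ i j → trans (adj-S _ _)
        (trans (cong₂ R (h-from P (to τ i)) (h-from P (to τ j))) (≡-sym (adj-Y i j))) }
    where open Inverse using (to)

-- Public copies of the block adjacencies kept private in Defs; c = false gives the 0-sum,
-- c = true the join.
sumAdj : Bool → (G H : Graph) → Fin (n G) ⊎ Fin (n H) → Fin (n G) ⊎ Fin (n H) → Bool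
sumAdj c G H (inj₁ x) (inj₁ y) = adj G x y
sumAdj c G H (inj₂ x) (inj₂ y) = adj H x y
sumAdj c G H (inj₁ x) (inj₂ y) = c
sumAdj c G H (inj₂ x) (inj₁ y) = c

adj-zeroSum : ∀ G H i j → adj (zeroSum G H) i j ≡ sumAdj false G H (splitAt (n G) i) (splitAt (n G) j)
adj-zeroSum G H i j with splitAt (n G) i | splitAt (n G) j
... | inj₁ x | inj₁ y = refl
... | inj₁ x | inj₂ y = refl
... | inj₂ x | inj₁ y = refl
... | inj₂ x | inj₂ y = refl

adj-join : ∀ G H i j → adj (join G H) i j ≡ sumAdj true G H (splitAt (n G) i) (splitAt (n G) j)
adj-join G H i j with splitAt (n G) i | splitAt (n G) j
... | inj₁ x | inj₁ y = refl
... | inj₁ x | inj₂ y = refl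
... | inj₂ x | inj₁ y = refl
... | inj₂ x | inj₂ y = refl

sumAdj-induced : ∀ c G H {p q} {l : Fin (suc p) → Fin (n G)} {r : Fin (suc q) → Fin (n H)}
  (li : Injective _≡_ _≡_ l) (ri : Injective _≡_ _≡_ r) s t →
  sumAdj c (induced G p l li) (induced H q r ri) s t ≡ sumAdj c G H (map l r s) (map l r t)
sumAdj-induced c G H li ri (inj₁ x) (inj₁ y) = refl
sumAdj-induced c G H li ri (inj₁ x) (inj₂ y) = refl
sumAdj-induced c G H li ri (inj₂ x) (inj₁ y) = refl
sumAdj-induced c G H li ri (inj₂ x) (inj₂ y) = refl

module _ (c : Bool) (C : Graph → Graph → Graph)
  (C-sesquicograph : ∀ {G H} → Sesquicograph G → Sesquicograph H → Sesquicograph (C G H))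
  (σ : ∀ G H → Fin (n (C G H)) ↔ (Fin (n G) ⊎ Fin (n H)))
  (adj-C : ∀ G H i j → adj (C G H) i j ≡ sumAdj c G H (Inverse.to (σ G H) i) (Inverse.to (σ G H) j)) where

  sum-hereditary : ∀ {G H} → Hereditary G → Hereditary H → Hereditary (C G H)
  sum-hereditary {G} {H} ihG ihH k f inj = restrict (partition (Inverse.to (σ G H) ∘ f))
    where
      open Blocks {S = C G H} (σ G H) (sumAdj c G H) (adj-C G H) inj
      restrict : Partition (Inverse.to (σ G H) ∘ f) → Sesquicograph (induced (C G H) k f inj)
      restrict record { p = zero ; q = zero ; blocks = β } = [ (λ ()) , (λ ()) ] (Inverse.to β zero)
      restrict P@record { p = suc _ ; q = zero } =
        iso (ihG _ _ li) (≅-induced P _ ↔⊎0 λ _ _ → refl)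
        where li = left-injective P blocks-injective
      restrict P@record { p = zero ; q = suc _ } =
        iso (ihH _ _ ri) (≅-induced P _ ↔0⊎ λ _ _ → refl)
        where ri = right-injective P blocks-injective
      restrict P@record { p = suc p′ ; q = suc q′ ; left = l ; right = r } =
        iso (C-sesquicograph (ihG p′ l li) (ihH q′ r ri))
            (≅-induced P (C G′ H′) (σ G′ H′) λ i j →
              trans (adj-C G′ H′ i j) (sumAdj-induced c G H li ri (to (σ G′ H′) i) (to (σ G′ H′) j)))
        where li = left-injective P blocks-injective
              ri = right-injective P blocks-injective
              G′ = induced G p′ l li
              H′ = induced H q′ r ri
              open Inverse using (to)

zeroSum-hereditary : ∀ {G H} → Hereditary G → Hereditary H → Hereditary (zeroSum G H)
zeroSum-hereditary = sum-hereditary false zeroSum zero-sum (λ _ _ → +↔⊎) adj-zeroSum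

join-hereditary : ∀ {G H} → Hereditary G → Hereditary H → Hereditary (join G H)
join-hereditary = sum-hereditary true join joined (λ _ _ → +↔⊎) adj-join

∷-punchIn-injective : ∀ {m q} (v : Fin (suc m)) {g : Fin q → Fin m} →
  Injective _≡_ _≡_ g → Injective _≡_ _≡_ (v ∷ punchIn v ∘ g)
∷-punchIn-injective v gi {zero}  {zero}  _ = refl
∷-punchIn-injective v gi {zero}  {suc y} e = ⊥-elim (punchInᵢ≢i v _ (≡-sym e))
∷-punchIn-injective v gi {suc x} {zero}  e = ⊥-elim (punchInᵢ≢i v _ e)
∷-punchIn-injective v gi {suc x} {suc y} e = cong suc (gi (punchIn-injective v _ _ e))

does-≟-injective : ∀ {p m} {g : Fin p → Fin m} → Injective _≡_ _≡_ g →
  ∀ {x₀ u} → g x₀ ≡ u → ∀ x → does (g x ≟ u) ≡ does (x ≟ x₀)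
does-≟-injective {g = g} gi {x₀} {u} gx₀≡u x = does-⇔
  (mk⇔ (λ gx≡u → gi (trans gx≡u (≡-sym gx₀≡u))) (λ x≡x₀ → trans (cong g x≡x₀) gx₀≡u))
  (g x ≟ u) (x ≟ x₀)

oneSumAdj : (G : Graph) (m : ℕ) (a : Fin (suc m) → Fin (suc m) → Bool) (u : Fin (n G)) (v : Fin (suc m)) →
  Fin (n G) ⊎ Fin m → Fin (n G) ⊎ Fin m → Bool
oneSumAdj G m a u v (inj₁ x) (inj₁ y) = adj G x y
oneSumAdj G m a u v (inj₂ x) (inj₂ y) = a (punchIn v x) (punchIn v y)
oneSumAdj G m a u v (inj₁ x) (inj₂ y) = if does (x ≟ u) then a v (punchIn v y) else false
oneSumAdj G m a u v (inj₂ x) (inj₁ y) = if does (y ≟ u) then a v (punchIn v x) else false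

adj-oneSumAux : ∀ G m a as ai u v i j →
  adj (oneSumAux G m a as ai u v) i j ≡ oneSumAdj G m a u v (splitAt (n G) i) (splitAt (n G) j)
adj-oneSumAux G m a as ai u v i j with splitAt (n G) i | splitAt (n G) j
... | inj₁ x | inj₁ y = refl
... | inj₁ x | inj₂ y = refl
... | inj₂ x | inj₁ y = refl
... | inj₂ x | inj₂ y = refl

module OneSum (G : Graph) (m : ℕ) (a : Fin (suc m) → Fin (suc m) → Bool)
  (as : ∀ i j → a i j ≡ a j i) (ai : ∀ i → a i i ≡ false) (u : Fin (n G)) (v : Fin (suc m)) where

  H : Graph
  H = record { n = suc m ; adj = a ; sym = as ; irrefl = ai }

  module _ {p} {l : Fin (suc p) → Fin (n G)} (li : Injective _≡_ _≡_ l) where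

    oneSumAdj-through : ∀ {q} {r : Fin q → Fin m} (r⁺i : Injective _≡_ _≡_ (v ∷ punchIn v ∘ r)) →
      ∀ {x₀} → l x₀ ≡ u → ∀ s t →
      oneSumAdj (induced G p l li) q (adj (induced H q (v ∷ punchIn v ∘ r) r⁺i)) x₀ zero s t
        ≡ oneSumAdj G m a u v (map l r s) (map l r t)
    oneSumAdj-through r⁺i lx₀≡u (inj₁ x) (inj₁ y) = refl
    oneSumAdj-through r⁺i lx₀≡u (inj₂ x) (inj₂ y) = refl
    oneSumAdj-through {r = r} r⁺i lx₀≡u (inj₁ x) (inj₂ y) =
      cong (λ b → if b then a v (punchIn v (r y)) else false) (≡-sym (does-≟-injective li lx₀≡u x))
    oneSumAdj-through {r = r} r⁺i lx₀≡u (inj₂ x) (inj₁ y) =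
      cong (λ b → if b then a v (punchIn v (r x)) else false) (≡-sym (does-≟-injective li lx₀≡u y))

    oneSumAdj-avoiding : ∀ {q} {r : Fin (suc q) → Fin m} (ri : Injective _≡_ _≡_ (punchIn v ∘ r)) →
      (∀ x → l x ≢ u) → ∀ s t →
      sumAdj false (induced G p l li) (induced H q (punchIn v ∘ r) ri) s t
        ≡ oneSumAdj G m a u v (map l r s) (map l r t)
    oneSumAdj-avoiding ri u∉l (inj₁ x) (inj₁ y) = refl
    oneSumAdj-avoiding ri u∉l (inj₂ x) (inj₂ y) = refl
    oneSumAdj-avoiding {r = r} ri u∉l (inj₁ x) (inj₂ y) =
      cong (λ b → if b then a v (punchIn v (r y)) else false) (≡-sym (dec-false (l x ≟ u) (u∉l x)))
    oneSumAdj-avoiding {r = r} ri u∉l (inj₂ x) (inj₁ y) =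
      cong (λ b → if b then a v (punchIn v (r x)) else false) (≡-sym (dec-false (l y ≟ u) (u∉l y)))

  hereditary : Hereditary G → Hereditary H → Hereditary (oneSumAux G m a as ai u v)
  hereditary ihG ihH k f inj = restrict (partition (splitAt (n G) ∘ f))
    where
      S = oneSumAux G m a as ai u v
      open Blocks {S = S} +↔⊎ (oneSumAdj G m a u v) (adj-oneSumAux G m a as ai u v) inj
      restrict : Partition (splitAt (n G) ∘ f) → Sesquicograph (induced S k f inj)
      restrict record { p = zero ; q = zero ; blocks = β } = [ (λ ()) , (λ ()) ] (Inverse.to β zero)
      restrict P@record { p = suc _ ; q = zero } =
        iso (ihG _ _ (left-injective P blocks-injective)) (≅-induced P _ ↔⊎0 λ _ _ → refl)
      restrict P@record { p = zero ; q = suc _ } =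
        iso (ihH _ _ (right-injective P blocks-injective ∘ punchIn-injective v _ _))
            (≅-induced P _ ↔0⊎ λ _ _ → refl)
      restrict P@record { p = suc p′ ; q = suc q′ ; left = l ; right = r } with any? (λ x → l x ≟ u)
      ... | yes (x₀ , lx₀≡u) =
        -- v stays in the H-side, as its vertex zero, to be glued to x₀
        iso (one-sum (ihG p′ l li) (ihH (suc q′) (v ∷ punchIn v ∘ r) r⁺i) x₀ zero)
            (≅-induced P (oneSum G′ H′ x₀ zero) +↔⊎ λ i j →
              trans (adj-oneSumAux G′ (suc q′) (adj H′) (Graph.sym H′) (irrefl H′) x₀ zero i j)
                    (oneSumAdj-through li r⁺i lx₀≡u (splitAt (suc p′) i) (splitAt (suc p′) j)))
        where li = left-injective P blocks-injective
              r⁺i = ∷-punchIn-injective v (right-injective P blocks-injective)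
              G′ = induced G p′ l li
              H′ = induced H (suc q′) (v ∷ punchIn v ∘ r) r⁺i
      ... | no u∉l =
        iso (zero-sum (ihG p′ l li) (ihH q′ (punchIn v ∘ r) ri))
            (≅-induced P (zeroSum G′ H′) +↔⊎ λ i j →
              trans (adj-zeroSum G′ H′ i j)
                    (oneSumAdj-avoiding li ri (λ x → u∉l ∘ (x ,_)) (splitAt (suc p′) i) (splitAt (suc p′) j)))
        where li = left-injective P blocks-injective
              ri : Injective _≡_ _≡_ (punchIn v ∘ r)
              ri = right-injective P blocks-injective ∘ punchIn-injective v _ _
              G′ = induced G p′ l li
              H′ = induced H q′ (punchIn v ∘ r) ri

oneSum-hereditary : ∀ {G H} → Hereditary G → Hereditary H → ∀ u v → Hereditary (oneSum G H u v)
oneSum-hereditary {G} {record { n = suc m ; adj = a ; sym = as ; irrefl = ai }} ihG ihH u v =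
  OneSum.hereditary G m a as ai u v ihG ihH

lemma2p4 : (G : Graph) → Sesquicograph G →
    (k : ℕ) (f : Fin (suc k) → Fin (n G)) (inj : Injective _≡_ _≡_ f) →
    Sesquicograph (induced G k f inj)
lemma2p4 _ k1                  = hereditary-K1
lemma2p4 _ (zero-sum sG sH)    = zeroSum-hereditary (lemma2p4 _ sG) (lemma2p4 _ sH)
lemma2p4 _ (joined sG sH)      = join-hereditary (lemma2p4 _ sG) (lemma2p4 _ sH)
lemma2p4 _ (one-sum sG sH u v) = oneSum-hereditary (lemma2p4 _ sG) (lemma2p4 _ sH) u v
lemma2p4 _ (iso sG G≅H)        = hereditary-≅ G≅H (lemma2p4 _ sG)
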